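{- For $n\ge 2$, $$g(n)\ge \left\lceil\frac{(n-1)^2+1}{2}\right\rceil.$$
   Context: A complete bipartite subgraph of a graph $G$ is given by two nonempty disjoint vertex sets $X,Y$ of $G$ such that every pair $xy$ with $x\in X,y\in Y$ is an edge of $G$; its edge set is all such pairs. A block is a set of the form $E(B_1)\times E(B_2)$ where $B_1,B_2$ are complete bipartite subgraphs of $K_n$. $g(n)$ is the minimum number of blocks needed to partition $E(K_n)\times E(K_n)$, where $K_n$ is the complete graph on $n$ vertices. -}

module Defs where

open import Data.Nat using (ℕ)
open import Data.Fin using (Fin; _<_)
open import Data.Fin.Subset using (Subset; _∈_; _∩_; Nonempty; Empty)
open import Data.Product using (_×_; ∃; proj₁; proj₂)
open import Data.Sum using (_⊎_)
open import Relation.Binary.PropositionalEquality using (_≡_)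

-- An edge of the complete graph K_n on vertex set Fin n: an unordered pair
-- {u , v} of distinct vertices, represented canonically with u < v.
record Edge (n : ℕ) : Set where
  constructor edge
  field
    u : Fin n
    v : Fin n
    u<v : u < v

record Biclique (n : ℕ) : Set where
  constructor biclique
  field
    X : Subset n
    Y : Subset n
    X-nonempty : Nonempty X
    Y-nonempty : Nonempty Y
    disjoint : Empty (X ∩ Y)

_∈E_ : ∀ {n} → Edge n → Biclique n → Set
e ∈E B = (Edge.u e ∈ Biclique.X B × Edge.v e ∈ Biclique.Y B)
       ⊎ (Edge.u e ∈ Biclique.Y B × Edge.v e ∈ Biclique.X B)

Block : ℕ → Set
Block n = Biclique n × Biclique n

_∈Block_ : ∀ {n} → Edge n × Edge n → Block n → Set
p ∈Block B = proj₁ p ∈E proj₁ B × proj₂ p ∈E proj₂ B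

IsPartition : ∀ {n k} → (Fin k → Block n) → Set
IsPartition {n} {k} P =
  (p : Edge n × Edge n) →
    ∃ (λ i → p ∈Block P i) × ((i j : Fin k) → p ∈Block P i → p ∈Block P j → i ≡ j)

module Submission where

-- Index integer matrices Z by pairs of vertices
-- of K_n, n = q + 1, and attach to a block E(B₁) × E(B₂) the 4-tensor
-- adj B₁ ⊗ adj B₂, where adj B = χX χYᵀ + χY χXᵀ is the adjacency matrix of the
-- biclique B = (X , Y).  A partition into k blocks says exactly that these
-- tensors add up to adjK ⊗ adjK, adjK being the adjacency matrix of K_n; hence
-- the quadratic form Z ↦ Σ Z(u,u') Z(v,v') K(u,u',v,v') of adjK ⊗ adjK is the
-- sum of those of the blocks.  The form of a block vanishes on the kernel of the
-- two linear forms ⟪ χX₁ χX₂ᵀ , · ⟫ and ⟪ χY₁ χX₂ᵀ , · ⟫.  Adding the 2q linear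
-- forms forcing all row and column sums to be equal, we get 2k + 2q forms in
-- (q + 1)² unknowns.  On their common kernel the form of adjK ⊗ adjK equals
-- n(n - 2)c² + Σ Z(u,u')², so only Z = 0 lies in it; as a homogeneous integer
-- system with fewer equations than unknowns has a nonzero solution, 2k > q².

open import Defs
open import Data.Nat as ℕ using (ℕ; zero; suc; s≤s; _≤_; _∸_; _^_; ⌈_/2⌉)
import Data.Nat.Tactic.RingSolver as ℕSolver
import Data.Nat.Properties as ℕ
open import Data.Integer using (ℤ; +_; -[1+_]; 0ℤ; 1ℤ; -1ℤ; _+_; _*_; -_; _-_)
open import Data.Integer.Properties
  using (+-*-semiring; _≟_; pos-+; pos-*; +-injective; *-cancelˡ-≡; i-j≡0⇒i≡j; +-identityˡ; +-assoc; *-distribˡ-+; +-identityʳ; *-zeroˡ; *-zeroʳ; *-identityˡ; *-identityʳ; -1*i≡-i; i*j≡0⇒i≡0∨j≡0)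
open import Data.Integer.Tactic.RingSolver using (solve-∀)
open import Data.Fin as Fin using (Fin; zero; suc; punchIn; _↑ˡ_; _↑ʳ_)
import Data.Fin.Properties as Fin
open import Data.Vec.Functional using (Vector; insertAt; removeAt; _++_)
open import Data.Vec.Functional.Properties using (insertAt-lookup; insertAt-punchIn; lookup-++ˡ; lookup-++ʳ)
open import Data.Product using (∃; _×_; _,_; proj₁; proj₂; uncurry)
open import Data.Bool using (true; false; if_then_else_)
open import Data.Fin.Subset using (Subset; _∈_)
open import Data.Fin.Subset.Properties using (x∈p∩q⁺)
open import Data.Vec using (lookup)
open import Data.Vec.Properties using ([]=⇒lookup; lookup⇒[]=)
open import Relation.Binary.Definitions using (tri<; tri≈; tri>)
open import Data.Sum using (_⊎_; inj₁; inj₂; [_,_])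
open import Function using (id)
open import Relation.Nullary using (¬_; Dec; yes; no; contradiction)
open import Relation.Binary.PropositionalEquality using (_≡_; refl; sym; trans; cong; cong₂; subst; subst₂; module ≡-Reasoning)
open ≡-Reasoning

open import Algebra.Properties.Semiring.Sum +-*-semiring
  using (sum; sum-syntax; sum-cong-≗; sum-replicate-zero; sum-remove; ∑-distrib-+; ∑-comm;
         *-distribˡ-sum; *-distribʳ-sum)

sum-zero : ∀ {m} (f : Vector ℤ m) → (∀ i → f i ≡ 0ℤ) → sum f ≡ 0ℤ
sum-zero {m} f f≡0 = trans (sum-cong-≗ f≡0) (sum-replicate-zero m)

sum-const : ∀ m c → ∑[ i < m ] c ≡ + m * c
sum-const zero    c = sym (*-zeroˡ c)
sum-const (suc m) c = trans (cong (_+_ c) (sum-const m c)) (one-plus (+ m) c)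
  where
  one-plus : ∀ a c → c + a * c ≡ (1ℤ + a) * c
  one-plus = solve-∀

sum-neg : ∀ {m} (f : Vector ℤ m) → ∑[ i < m ] (- f i) ≡ - sum f
sum-neg f = begin
  sum (λ i → - f i)      ≡⟨ sum-cong-≗ (λ i → sym (-1*i≡-i (f i))) ⟩
  sum (λ i → -1ℤ * f i)  ≡⟨ *-distribˡ-sum -1ℤ f ⟨
  -1ℤ * sum f            ≡⟨ -1*i≡-i (sum f) ⟩
  - sum f                ∎

sum-sub : ∀ {m} (f g : Vector ℤ m) → ∑[ i < m ] (f i - g i) ≡ sum f - sum g
sum-sub f g = trans (∑-distrib-+ f (λ i → - g i)) (cong (_+_ (sum f)) (sum-neg g))

sum-split : ∀ k {l} (f : Vector ℤ (k ℕ.+ l)) →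
            sum f ≡ ∑[ i < k ] f (i ↑ˡ l) + ∑[ j < l ] f (k ↑ʳ j)
sum-split zero    f = sym (+-identityˡ (sum f))
sum-split (suc k) f = trans (cong (_+_ (f zero)) (sum-split k (λ i → f (suc i))))
  (sym (+-assoc (f zero) _ _))

sum-combine : ∀ {m l} (f : Vector ℤ (m ℕ.* l)) →
              sum f ≡ ∑[ i < m ] ∑[ j < l ] f (Fin.combine i j)
sum-combine {zero}      f = refl
sum-combine {suc m} {l} f =
  trans (sum-split l f) (cong (_+_ (∑[ j < l ] f (j ↑ˡ (m ℕ.* l)))) (sum-combine {m} (λ i → f (l ↑ʳ i))))

all-++ : ∀ {A : Set} {m l} {Q : A → Set} (f : Vector A m) (g : Vector A l) →
         (∀ i → Q ((f ++ g) i)) → (∀ i → Q (f i)) × (∀ i → Q (g i))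
all-++ {Q = Q} f g all = (λ i → subst Q (lookup-++ˡ f g i) (all (i ↑ˡ _)))
                       , (λ i → subst Q (lookup-++ʳ f g i) (all (_ ↑ʳ i)))

-- Homogeneous linear systems over ℤ: an equation is a coefficient vector a,
-- asking for dot a t = 0.

dot : ∀ {m} → Vector ℤ m → Vector ℤ m → ℤ
dot {m} a t = ∑[ j < m ] (a j * t j)

Nonzero : ∀ {m} → Vector ℤ m → Set
Nonzero t = ∃ λ j → ¬ t j ≡ 0ℤ

zero-or-nonzero : ∀ {m} (a : Vector ℤ m) → (∀ j → a j ≡ 0ℤ) ⊎ Nonzero a
zero-or-nonzero {zero}  a = inj₁ λ ()
zero-or-nonzero {suc m} a with a zero ≟ 0ℤ | zero-or-nonzero (λ j → a (suc j))
... | no a₀≢0 | _                  = inj₂ (zero , a₀≢0)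
... | yes a₀≡0 | inj₁ rest≡0       = inj₁ λ { zero → a₀≡0 ; (suc j) → rest≡0 j }
... | yes _    | inj₂ (j , aⱼ≢0)   = inj₂ (suc j , aⱼ≢0)

-- Gaussian elimination of the variable j by means of the equation a · t = 0.
-- Every s in the remaining m variables lifts to a solution of a · t = 0, and
-- any other equation b · t = 0 becomes the reduced equation (reduce b) · s = 0.
module Eliminate {m} (a : Vector ℤ (suc m)) (j : Fin (suc m)) where

  lift : Vector ℤ m → Vector ℤ (suc m)
  lift s = insertAt (λ l → a j * s l) j (- dot (removeAt a j) s)

  reduce : Vector ℤ (suc m) → Vector ℤ m
  reduce b l = b (punchIn j l) * a j - b j * a (punchIn j l)

  dot-lift : ∀ b s → dot b (lift s) ≡ dot (reduce b) s
  dot-lift b s = begin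
    dot b (lift s)
      ≡⟨ sum-remove {i = j} (λ i → b i * lift s i) ⟩
    b j * lift s j + ∑[ l < m ] (b (punchIn j l) * lift s (punchIn j l))
      ≡⟨ cong₂ _+_ (cong (b j *_) (insertAt-lookup _ j _))
                   (sum-cong-≗ λ l → cong (b (punchIn j l) *_) (insertAt-punchIn _ j _ l)) ⟩
    b j * (- dot (removeAt a j) s) + ∑[ l < m ] (b (punchIn j l) * (a j * s l))
      ≡⟨ cong (_+ ∑[ l < m ] (b (punchIn j l) * (a j * s l)))
              (trans (neg-inside (b j) (dot (removeAt a j) s))
                     (*-distribˡ-sum (- b j) (λ l → a (punchIn j l) * s l))) ⟩
    ∑[ l < m ] (- b j * (a (punchIn j l) * s l)) + ∑[ l < m ] (b (punchIn j l) * (a j * s l))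
      ≡⟨ ∑-distrib-+ (λ l → - b j * (a (punchIn j l) * s l)) (λ l → b (punchIn j l) * (a j * s l)) ⟨
    ∑[ l < m ] (- b j * (a (punchIn j l) * s l) + b (punchIn j l) * (a j * s l))
      ≡⟨ sum-cong-≗ (λ l → regroup (b j) (a (punchIn j l)) (s l) (b (punchIn j l)) (a j)) ⟩
    dot (reduce b) s ∎
    where
    neg-inside : ∀ x y → x * (- y) ≡ - x * y
    neg-inside = solve-∀
    regroup : ∀ bj ap sl bp aj → - bj * (ap * sl) + bp * (aj * sl) ≡ (bp * aj - bj * ap) * sl
    regroup = solve-∀

  reduce-pivot : ∀ s → dot (reduce a) s ≡ 0ℤ
  reduce-pivot s = sum-zero _ λ l → cancel (a (punchIn j l)) (a j) (s l)
    where
    cancel : ∀ x y z → (x * y - y * x) * z ≡ 0ℤ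
    cancel = solve-∀

  -- Since ℤ has no zero divisors, lifting keeps solutions nonzero.
  lift-nonzero : ¬ a j ≡ 0ℤ → ∀ s → Nonzero s → Nonzero (lift s)
  lift-nonzero aⱼ≢0 s (l , sₗ≢0) = punchIn j l , λ liftₗ≡0 →
    [ aⱼ≢0 , sₗ≢0 ] (i*j≡0⇒i≡0∨j≡0 (a j) (trans (sym (insertAt-punchIn _ j _ l)) liftₗ≡0))

underdetermined-solution : ∀ {r m} → r ℕ.< m → (a : Fin r → Vector ℤ m) →
                           ∃ λ t → Nonzero t × (∀ i → dot (a i) t ≡ 0ℤ)
underdetermined-solution {zero}  {suc m} _ a = (λ _ → 1ℤ) , (zero , λ ()) , λ ()
underdetermined-solution {suc r} {suc m} (s≤s r<m) a with zero-or-nonzero (a zero)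
... | inj₁ a₀≡0 =
  let t , t≢0 , solves = underdetermined-solution (ℕ.m<n⇒m<1+n r<m) (λ i → a (suc i))
  in t , t≢0 , λ { zero    → sum-zero _ λ l → trans (cong (_* t l) (a₀≡0 l)) (*-zeroˡ (t l))
                 ; (suc i) → solves i }
... | inj₂ (j , a₀ⱼ≢0) =
  let open Eliminate (a zero) j
      s , s≢0 , solves = underdetermined-solution r<m (λ i → reduce (a (suc i)))
  in lift s , lift-nonzero a₀ⱼ≢0 s s≢0
            , λ { zero    → trans (dot-lift (a zero) s) (reduce-pivot s)
                ; (suc i) → trans (dot-lift (a (suc i)) s) (solves i) }

-- Nonnegative integers, stated as the image of ℕ in ℤ so that their sums and
-- products are computed in ℕ.

NonNeg : ℤ → Set
NonNeg x = ∃ λ m → x ≡ + m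

square-nonneg : ∀ x → NonNeg (x * x)
square-nonneg (+ m)      = m ℕ.* m , sym (pos-* m m)
square-nonneg -[1+ m ]   = suc m ℕ.* suc m , refl

nonneg-* : ∀ {x y} → NonNeg x → NonNeg y → NonNeg (x * y)
nonneg-* (a , refl) (b , refl) = a ℕ.* b , sym (pos-* a b)

nonneg-+ : ∀ {x y} → NonNeg x → NonNeg y → NonNeg (x + y)
nonneg-+ (a , refl) (b , refl) = a ℕ.+ b , sym (pos-+ a b)

nonneg-sum : ∀ {m} (f : Vector ℤ m) → (∀ i → NonNeg (f i)) → NonNeg (sum f)
nonneg-sum {zero}  f f≥0 = 0 , refl
nonneg-sum {suc m} f f≥0 = nonneg-+ (f≥0 zero) (nonneg-sum (λ i → f (suc i)) (λ i → f≥0 (suc i)))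

nonneg-+-zero : ∀ {x y} → NonNeg x → NonNeg y → x + y ≡ 0ℤ → x ≡ 0ℤ × y ≡ 0ℤ
nonneg-+-zero (a , refl) (b , refl) a+b≡0 = cong +_ (ℕ.m+n≡0⇒m≡0 a a+b≡0ℕ) , cong +_ (ℕ.m+n≡0⇒n≡0 a a+b≡0ℕ)
  where
  a+b≡0ℕ : a ℕ.+ b ≡ 0
  a+b≡0ℕ = +-injective (trans (pos-+ a b) a+b≡0)

nonneg-sum-zero : ∀ {m} (f : Vector ℤ m) → (∀ i → NonNeg (f i)) → sum f ≡ 0ℤ → ∀ i → f i ≡ 0ℤ
nonneg-sum-zero f f≥0 ∑f≡0 zero =
  proj₁ (nonneg-+-zero (f≥0 zero) (nonneg-sum (λ i → f (suc i)) (λ i → f≥0 (suc i))) ∑f≡0)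
nonneg-sum-zero f f≥0 ∑f≡0 (suc i) =
  nonneg-sum-zero (λ i → f (suc i)) (λ i → f≥0 (suc i))
    (proj₂ (nonneg-+-zero (f≥0 zero) (nonneg-sum (λ i → f (suc i)) (λ i → f≥0 (suc i))) ∑f≡0)) i

Indicator : ℤ → Set → Set
Indicator z P = (z ≡ 1ℤ × P) ⊎ (z ≡ 0ℤ × ¬ P)

indicator-true : ∀ {z P} → Indicator z P → P → z ≡ 1ℤ
indicator-true (inj₁ (z≡1 , _)) _ = z≡1
indicator-true (inj₂ (_ , ¬p))  p = contradiction p ¬p

indicator-false : ∀ {z P} → Indicator z P → ¬ P → z ≡ 0ℤ
indicator-false (inj₁ (_ , p))   ¬p = contradiction p ¬p
indicator-false (inj₂ (z≡0 , _)) _  = z≡0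

indicator-* : ∀ {a b P Q} → Indicator a P → Indicator b Q → Indicator (a * b) (P × Q)
indicator-* (inj₁ (refl , p)) (inj₁ (refl , q))  = inj₁ (refl , p , q)
indicator-* (inj₁ (refl , _)) (inj₂ (refl , ¬q)) = inj₂ (refl , λ pq → ¬q (proj₂ pq))
indicator-* (inj₂ (refl , ¬p)) _ = inj₂ (refl , λ pq → ¬p (proj₁ pq))

indicator-+ : ∀ {a b P Q} → ¬ (P × Q) → Indicator a P → Indicator b Q → Indicator (a + b) (P ⊎ Q)
indicator-+ excl (inj₁ (refl , p))  (inj₁ (refl , q))  = contradiction (p , q) excl
indicator-+ excl (inj₁ (refl , p))  (inj₂ (refl , _))  = inj₁ (refl , inj₁ p)
indicator-+ excl (inj₂ (refl , _))  (inj₁ (refl , q))  = inj₁ (refl , inj₂ q)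
indicator-+ excl (inj₂ (refl , ¬p)) (inj₂ (refl , ¬q)) = inj₂ (refl , [ ¬p , ¬q ])

sum-select : ∀ {k} {P : Fin k → Set} (z g : Vector ℤ k) → (∀ i → Indicator (z i) (P i)) →
             (i₀ : Fin k) → P i₀ → (∀ i j → P i → P j → i ≡ j) → ∑[ i < k ] (z i * g i) ≡ g i₀
sum-select {suc k} z g z↔P i₀ pᵢ₀ unique = begin
  ∑[ i < suc k ] (z i * g i)                             ≡⟨ sum-remove {i = i₀} (λ i → z i * g i) ⟩
  z i₀ * g i₀ + ∑[ l < k ] (z (punchIn i₀ l) * g (punchIn i₀ l))
    ≡⟨ cong₂ _+_ (cong (_* g i₀) (indicator-true (z↔P i₀) pᵢ₀)) (sum-zero _ others-vanish) ⟩
  1ℤ * g i₀ + 0ℤ                                         ≡⟨ trans (+-identityʳ _) (*-identityˡ (g i₀)) ⟩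
  g i₀                                                   ∎
  where
  others-vanish : ∀ l → z (punchIn i₀ l) * g (punchIn i₀ l) ≡ 0ℤ
  others-vanish l = trans (cong (_* g (punchIn i₀ l)) (indicator-false (z↔P (punchIn i₀ l))
                      λ p → Fin.punchInᵢ≢i i₀ l (unique _ _ p pᵢ₀)))
                      (*-zeroˡ (g (punchIn i₀ l)))

Mat : ℕ → Set
Mat n = Fin n → Fin n → ℤ

⟪_,_⟫ : ∀ {n} → Mat n → Mat n → ℤ
⟪_,_⟫ {n} M Z = ∑[ u < n ] ∑[ u' < n ] (M u u' * Z u u')

Row Col : ∀ {n} → Mat n → Fin n → ℤ
Row {n} Z u  = ∑[ u' < n ] Z u u'
Col {n} Z u' = ∑[ u < n ] Z u u'

pairing-sub : ∀ {n} (M N Z : Mat n) → ⟪ (λ u u' → M u u' - N u u') , Z ⟫ ≡ ⟪ M , Z ⟫ - ⟪ N , Z ⟫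
pairing-sub {n} M N Z = begin
  ⟪ (λ u u' → M u u' - N u u') , Z ⟫
    ≡⟨ sum-cong-≗ (λ u → trans (sum-cong-≗ λ u' → distrib (M u u') (N u u') (Z u u'))
                               (sum-sub (λ u' → M u u' * Z u u') (λ u' → N u u' * Z u u'))) ⟩
  ∑[ u < n ] (∑[ u' < n ] (M u u' * Z u u') - ∑[ u' < n ] (N u u' * Z u u'))
    ≡⟨ sum-sub (λ u → ∑[ u' < n ] (M u u' * Z u u')) (λ u → ∑[ u' < n ] (N u u' * Z u u')) ⟩
  ⟪ M , Z ⟫ - ⟪ N , Z ⟫ ∎
  where
  distrib : ∀ x y z → (x - y) * z ≡ x * z - y * z
  distrib = solve-∀

δ : ∀ {n} → Fin n → Fin n → ℤ
δ a u with a Fin.≟ u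
... | yes _ = 1ℤ
... | no _  = 0ℤ

δ-indicator : ∀ {n} (a u : Fin n) → Indicator (δ a u) (a ≡ u)
δ-indicator a u with a Fin.≟ u
... | yes a≡u = inj₁ (refl , a≡u)
... | no a≢u  = inj₂ (refl , a≢u)

sum-δ : ∀ {n} (a : Fin n) (g : Vector ℤ n) → ∑[ u < n ] (δ a u * g u) ≡ g a
sum-δ a g = sum-select (δ a) g (δ-indicator a) a refl (λ u v a≡u a≡v → trans (sym a≡u) a≡v)

pairing-row : ∀ {n} (a : Fin n) (Z : Mat n) → ⟪ (λ u u' → δ a u) , Z ⟫ ≡ Row Z a
pairing-row a Z = trans (sum-cong-≗ λ u → sym (*-distribˡ-sum (δ a u) (Z u))) (sum-δ a (Row Z))

pairing-col : ∀ {n} (a : Fin n) (Z : Mat n) → ⟪ (λ u u' → δ a u') , Z ⟫ ≡ Col Z a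
pairing-col a Z = sum-cong-≗ λ u → sum-δ a (Z u)

pairing-rowDiff : ∀ {n} (a b : Fin n) (Z : Mat n) → ⟪ (λ u u' → δ a u - δ b u) , Z ⟫ ≡ Row Z a - Row Z b
pairing-rowDiff a b Z =
  trans (pairing-sub (λ u u' → δ a u) (λ u u' → δ b u) Z) (cong₂ _-_ (pairing-row a Z) (pairing-row b Z))

pairing-colDiff : ∀ {n} (a b : Fin n) (Z : Mat n) → ⟪ (λ u u' → δ a u' - δ b u') , Z ⟫ ≡ Col Z a - Col Z b
pairing-colDiff a b Z =
  trans (pairing-sub (λ u u' → δ a u') (λ u u' → δ b u') Z) (cong₂ _-_ (pairing-col a Z) (pairing-col b Z))

adjK : ∀ {n} → Mat n
adjK a u = 1ℤ - δ a u

adjK-diag : ∀ {n} (u : Fin n) → adjK u u ≡ 0ℤ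
adjK-diag u = cong (_-_ 1ℤ) (indicator-true (δ-indicator u u) refl)

adjK-distinct : ∀ {n} {u v : Fin n} → ¬ u ≡ v → adjK u v ≡ 1ℤ
adjK-distinct {u = u} {v} u≢v = cong (_-_ 1ℤ) (indicator-false (δ-indicator u v) u≢v)

sum-adjK : ∀ {n} (a : Fin n) (g : Vector ℤ n) → ∑[ u < n ] (adjK a u * g u) ≡ sum g - g a
sum-adjK a g = begin
  sum (λ u → adjK a u * g u)      ≡⟨ sum-cong-≗ (λ u → distrib (δ a u) (g u)) ⟩
  sum (λ u → g u - δ a u * g u)   ≡⟨ sum-sub g (λ u → δ a u * g u) ⟩
  sum g - sum (λ u → δ a u * g u) ≡⟨ cong (_-_ (sum g)) (sum-δ a g) ⟩
  sum g - g a                     ∎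
  where
  distrib : ∀ d x → (1ℤ - d) * x ≡ x - d * x
  distrib = solve-∀

Tensor : ℕ → Set
Tensor n = Fin n → Fin n → Fin n → Fin n → ℤ

∑⁴ : ∀ {n} → Tensor n → ℤ
∑⁴ {n} F = ∑[ u < n ] ∑[ u' < n ] ∑[ v < n ] ∑[ v' < n ] F u u' v v'

∑⁴-cong : ∀ {n} {F G : Tensor n} → (∀ u u' v v' → F u u' v v' ≡ G u u' v v') → ∑⁴ F ≡ ∑⁴ G
∑⁴-cong F≡G = sum-cong-≗ λ u → sum-cong-≗ λ u' → sum-cong-≗ λ v → sum-cong-≗ λ v' → F≡G u u' v v'

∑⁴-distrib-+ : ∀ {n} (F G : Tensor n) → ∑⁴ (λ u u' v v' → F u u' v v' + G u u' v v') ≡ ∑⁴ F + ∑⁴ G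
∑⁴-distrib-+ F G =
  trans (sum-cong-≗ λ u → sum-cong-≗ λ u' → sum-cong-≗ λ v → ∑-distrib-+ (F u u' v) (G u u' v))
 (trans (sum-cong-≗ λ u → sum-cong-≗ λ u' → ∑-distrib-+ (λ v → sum (F u u' v)) (λ v → sum (G u u' v)))
 (trans (sum-cong-≗ λ u → ∑-distrib-+ (λ u' → ∑[ v < _ ] sum (F u u' v)) (λ u' → ∑[ v < _ ] sum (G u u' v)))
        (∑-distrib-+ (λ u → ∑[ u' < _ ] ∑[ v < _ ] sum (F u u' v)) (λ u → ∑[ u' < _ ] ∑[ v < _ ] sum (G u u' v)))))

∑⁴-comm : ∀ {n k} (F : Fin k → Tensor n) →
          ∑⁴ (λ u u' v v' → ∑[ i < k ] F i u u' v v') ≡ ∑[ i < k ] ∑⁴ (F i)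
∑⁴-comm F =
  trans (sum-cong-≗ λ u → sum-cong-≗ λ u' → sum-cong-≗ λ v → ∑-comm (λ v' i → F i u u' v v'))
 (trans (sum-cong-≗ λ u → sum-cong-≗ λ u' → ∑-comm (λ v i → sum (F i u u' v)))
 (trans (sum-cong-≗ λ u → ∑-comm (λ u' i → ∑[ v < _ ] sum (F i u u' v)))
        (∑-comm (λ u i → ∑[ u' < _ ] ∑[ v < _ ] sum (F i u u' v)))))

∑⁴-product : ∀ {n} (F G : Mat n) →
             ∑⁴ (λ u u' v v' → F u u' * G v v') ≡ ∑[ u < n ] ∑[ u' < n ] F u u' * ∑[ v < n ] ∑[ v' < n ] G v v'
∑⁴-product {n} F G = sym
  (trans (*-distribʳ-sum ∑G (λ u → sum (F u)))
  (sum-cong-≗ λ u → trans (*-distribʳ-sum ∑G (F u))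
  (sum-cong-≗ λ u' → trans (*-distribˡ-sum (F u u') (λ v → sum (G v)))
  (sum-cong-≗ λ v → *-distribˡ-sum (F u u') (G v)))))
  where ∑G = ∑[ v < n ] ∑[ v' < n ] G v v'

quad : ∀ {n} → Mat n → Tensor n → ℤ
quad Z K = ∑⁴ (λ u u' v v' → Z u u' * Z v v' * K u u' v v')

quad-cong : ∀ {n} (Z : Mat n) {K L : Tensor n} → (∀ u u' v v' → K u u' v v' ≡ L u u' v v') → quad Z K ≡ quad Z L
quad-cong Z K≡L = ∑⁴-cong λ u u' v v' → cong (Z u u' * Z v v' *_) (K≡L u u' v v')

quad-+ : ∀ {n} (Z : Mat n) (K L : Tensor n) → quad Z (λ u u' v v' → K u u' v v' + L u u' v v') ≡ quad Z K + quad Z L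
quad-+ Z K L = trans (∑⁴-cong λ u u' v v' → *-distribˡ-+ (Z u u' * Z v v') (K u u' v v') (L u u' v v'))
                     (∑⁴-distrib-+ (λ u u' v v' → Z u u' * Z v v' * K u u' v v')
                                   (λ u u' v v' → Z u u' * Z v v' * L u u' v v'))

quad-∑ : ∀ {n k} (Z : Mat n) (K : Fin k → Tensor n) →
         quad Z (λ u u' v v' → ∑[ i < k ] K i u u' v v') ≡ ∑[ i < k ] quad Z (K i)
quad-∑ Z K = trans (∑⁴-cong λ u u' v v' → *-distribˡ-sum (Z u u' * Z v v') (λ i → K i u u' v v'))
                   (∑⁴-comm (λ i u u' v v' → Z u u' * Z v v' * K i u u' v v'))

_⊙_ : ∀ {n} → Vector ℤ n → Vector ℤ n → Mat n
(p ⊙ r) u u' = p u * r u'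

quad-product : ∀ {n} (Z : Mat n) (p q r s : Vector ℤ n) →
               quad Z (λ u u' v v' → p u * q v * (r u' * s v')) ≡ ⟪ p ⊙ r , Z ⟫ * ⟪ q ⊙ s , Z ⟫
quad-product Z p q r s =
  trans (∑⁴-cong λ u u' v v' → regroup (Z u u') (Z v v') (p u) (q v) (r u') (s v'))
        (∑⁴-product (λ u u' → p u * r u' * Z u u') (λ v v' → q v * s v' * Z v v'))
  where
  regroup : ∀ z z' a b c d → z * z' * (a * b * (c * d)) ≡ a * c * z * (b * d * z')
  regroup = solve-∀

-- The symmetric matrix p qᵀ + q pᵀ; the adjacency matrix of a complete
-- bipartite graph has this shape.
symOuter : ∀ {n} → Vector ℤ n → Vector ℤ n → Mat n
symOuter p q u v = p u * q v + q u * p v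

_⊗_ : ∀ {n} → Mat n → Mat n → Tensor n
(A ⊗ B) u u' v v' = A u v * B u' v'

-- The quadratic form of symOuter p q ⊗ symOuter r s is a sum of four products of
-- linear forms, each of which contains ⟪ p ⊙ r , Z ⟫ or ⟪ q ⊙ r , Z ⟫; so it
-- vanishes on the common kernel of these two linear forms.
quad-symOuter-vanishes : ∀ {n} (Z : Mat n) (p q r s : Vector ℤ n) →
  ⟪ p ⊙ r , Z ⟫ ≡ 0ℤ → ⟪ q ⊙ r , Z ⟫ ≡ 0ℤ → quad Z (symOuter p q ⊗ symOuter r s) ≡ 0ℤ
quad-symOuter-vanishes Z p q r s pr≡0 qr≡0 = begin
  quad Z (symOuter p q ⊗ symOuter r s)
    ≡⟨ quad-cong Z (λ u u' v v' → expand (p u) (q v) (q u) (p v) (r u') (s v') (s u') (r v')) ⟩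
  quad Z (λ u u' v v' → R p q r s u u' v v' + (R p q s r u u' v v' + (R q p r s u u' v v' + R q p s r u u' v v')))
    ≡⟨ quad-+ Z (R p q r s) _ ⟩
  quad Z (R p q r s) + quad Z (λ u u' v v' → R p q s r u u' v v' + (R q p r s u u' v v' + R q p s r u u' v v'))
    ≡⟨ cong (_+_ (quad Z (R p q r s))) (trans (quad-+ Z (R p q s r) _) (cong (_+_ (quad Z (R p q s r))) (quad-+ Z (R q p r s) (R q p s r)))) ⟩
  quad Z (R p q r s) + (quad Z (R p q s r) + (quad Z (R q p r s) + quad Z (R q p s r)))
    ≡⟨ cong₂ _+_ (quad-product Z p q r s)
         (cong₂ _+_ (quad-product Z p q s r) (cong₂ _+_ (quad-product Z q p r s) (quad-product Z q p s r))) ⟩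
  ⟪ p ⊙ r , Z ⟫ * ⟪ q ⊙ s , Z ⟫ + (⟪ p ⊙ s , Z ⟫ * ⟪ q ⊙ r , Z ⟫ + (⟪ q ⊙ r , Z ⟫ * ⟪ p ⊙ s , Z ⟫ + ⟪ q ⊙ s , Z ⟫ * ⟪ p ⊙ r , Z ⟫))
    ≡⟨ vanish ⟪ q ⊙ s , Z ⟫ ⟪ p ⊙ s , Z ⟫ pr≡0 qr≡0 ⟩
  0ℤ ∎
  where
  R : ∀ {n} → Vector ℤ n → Vector ℤ n → Vector ℤ n → Vector ℤ n → Tensor n
  R p q r s u u' v v' = p u * q v * (r u' * s v')
  expand : ∀ pu qv qu pv ru' sv' su' rv' →
    (pu * qv + qu * pv) * (ru' * sv' + su' * rv') ≡
    pu * qv * (ru' * sv') + (pu * qv * (su' * rv') + (qu * pv * (ru' * sv') + qu * pv * (su' * rv')))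
  expand = solve-∀
  vanish : ∀ {x y} a b → x ≡ 0ℤ → y ≡ 0ℤ → x * a + (b * y + (y * b + a * x)) ≡ 0ℤ
  vanish a b refl refl = zeros a b
    where
    zeros : ∀ a b → 0ℤ * a + (b * 0ℤ + (0ℤ * b + a * 0ℤ)) ≡ 0ℤ
    zeros = solve-∀

quad-adjK : ∀ {n} (Z : Mat n) (c : ℤ) → (∀ u → Row Z u ≡ c) → (∀ u' → Col Z u' ≡ c) →
            quad Z (adjK ⊗ adjK) ≡ + n * (c * (+ n * c - c - c)) + ⟪ Z , Z ⟫
quad-adjK {n} Z c rows cols = begin
  quad Z (adjK ⊗ adjK)
    ≡⟨ sum-cong-≗ (λ u → sum-cong-≗ λ u' → inner u u') ⟩
  ∑[ u < n ] ∑[ u' < n ] (Z u u' * K + Z u u' * Z u u')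
    ≡⟨ sum-cong-≗ (λ u → ∑-distrib-+ (λ u' → Z u u' * K) (λ u' → Z u u' * Z u u')) ⟩
  ∑[ u < n ] (∑[ u' < n ] (Z u u' * K) + ∑[ u' < n ] (Z u u' * Z u u'))
    ≡⟨ ∑-distrib-+ (λ u → ∑[ u' < n ] (Z u u' * K)) (λ u → ∑[ u' < n ] (Z u u' * Z u u')) ⟩
  ∑[ u < n ] ∑[ u' < n ] (Z u u' * K) + ⟪ Z , Z ⟫
    ≡⟨ cong (_+ ⟪ Z , Z ⟫) (trans (sum-cong-≗ λ u → trans (sym (*-distribʳ-sum K (Z u))) (cong (_* K) (rows u)))
                                   (sum-const n (c * K))) ⟩
  + n * (c * K) + ⟪ Z , Z ⟫ ∎
  where
  K = + n * c - c - c
  inner : ∀ u u' → ∑[ v < n ] ∑[ v' < n ] (Z u u' * Z v v' * (adjK u v * adjK u' v')) ≡ Z u u' * K + Z u u' * Z u u'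
  inner u u' = begin
    ∑[ v < n ] ∑[ v' < n ] (Z u u' * Z v v' * (adjK u v * adjK u' v'))
      ≡⟨ sum-cong-≗ (λ v → sum-cong-≗ λ v' → regroup (Z u u') (Z v v') (adjK u v) (adjK u' v')) ⟩
    ∑[ v < n ] ∑[ v' < n ] (Z u u' * (adjK u v * (adjK u' v' * Z v v')))
      ≡⟨ sum-cong-≗ (λ v → sym (trans (cong (Z u u' *_) (*-distribˡ-sum (adjK u v) (λ v' → adjK u' v' * Z v v')))
                                      (*-distribˡ-sum (Z u u') (λ v' → adjK u v * (adjK u' v' * Z v v'))))) ⟩
    ∑[ v < n ] (Z u u' * (adjK u v * ∑[ v' < n ] (adjK u' v' * Z v v')))
      ≡⟨ *-distribˡ-sum (Z u u') (λ v → adjK u v * ∑[ v' < n ] (adjK u' v' * Z v v')) ⟨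
    Z u u' * ∑[ v < n ] (adjK u v * ∑[ v' < n ] (adjK u' v' * Z v v'))
      ≡⟨ cong (Z u u' *_) (sum-cong-≗ λ v → cong (adjK u v *_) (trans (sum-adjK u' (Z v)) (cong (_- Z v u') (rows v)))) ⟩
    Z u u' * ∑[ v < n ] (adjK u v * (c - Z v u'))
      ≡⟨ cong (Z u u' *_) (sum-adjK u (λ v → c - Z v u')) ⟩
    Z u u' * (∑[ v < n ] (c - Z v u') - (c - Z u u'))
      ≡⟨ cong (λ x → Z u u' * (x - (c - Z u u'))) (trans (sum-sub (λ _ → c) (λ v → Z v u'))
                                                         (cong₂ _-_ (sum-const n c) (cols u'))) ⟩
    Z u u' * ((+ n * c - c) - (c - Z u u'))
      ≡⟨ simplify (Z u u') (+ n * c) c ⟩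
    Z u u' * K + Z u u' * Z u u' ∎
    where
    regroup : ∀ z z' a b → z * z' * (a * b) ≡ z * (a * (b * z'))
    regroup = solve-∀
    simplify : ∀ z nc c → z * ((nc - c) - (c - z)) ≡ z * (nc - c - c) + z * z
    simplify = solve-∀

complete-term-nonneg : ∀ p c → NonNeg (+ (2 ℕ.+ p) * (c * (+ (2 ℕ.+ p) * c - c - c)))
complete-term-nonneg p c =
  subst NonNeg (sym (factor (+ p) c)) (nonneg-* (2 ℕ.+ p , refl) (nonneg-* (p , refl) (square-nonneg c)))
  where
  factor : ∀ x c → (+ 2 + x) * (c * ((+ 2 + x) * c - c - c)) ≡ (+ 2 + x) * (x * (c * c))
  factor = solve-∀

pairing-self-nonneg : ∀ {n} (Z : Mat n) → NonNeg ⟪ Z , Z ⟫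
pairing-self-nonneg Z = nonneg-sum _ λ u → nonneg-sum _ λ u' → square-nonneg (Z u u')

pairing-self-zero : ∀ {n} (Z : Mat n) → ⟪ Z , Z ⟫ ≡ 0ℤ → ∀ u u' → Z u u' ≡ 0ℤ
pairing-self-zero {n} Z ZZ≡0 u u' = [ id , id ] (i*j≡0⇒i≡0∨j≡0 (Z u u') square≡0)
  where
  rowSquares≡0 : ∀ u → ∑[ u' < n ] (Z u u' * Z u u') ≡ 0ℤ
  rowSquares≡0 = nonneg-sum-zero _ (λ u → nonneg-sum _ λ u' → square-nonneg (Z u u')) ZZ≡0
  square≡0 : Z u u' * Z u u' ≡ 0ℤ
  square≡0 = nonneg-sum-zero _ (λ u' → square-nonneg (Z u u')) (rowSquares≡0 u) u'

-- If all row sums agree and all column sums agree, then they agree with each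
-- other, since both count the total sum of the entries.
balanced : ∀ {q} (Z : Mat (suc q)) → (∀ u → Row Z u ≡ Row Z zero) → (∀ u → Col Z u ≡ Col Z zero) →
           Col Z zero ≡ Row Z zero
balanced {q} Z rows cols = *-cancelˡ-≡ (+ suc q) (Col Z zero) (Row Z zero) (begin
  + suc q * Col Z zero      ≡⟨ sum-const (suc q) (Col Z zero) ⟨
  ∑[ u' < suc q ] Col Z zero ≡⟨ sum-cong-≗ cols ⟨
  ∑[ u' < suc q ] Col Z u'   ≡⟨ ∑-comm Z ⟨
  ∑[ u < suc q ] Row Z u     ≡⟨ sum-cong-≗ rows ⟩
  ∑[ u < suc q ] Row Z zero  ≡⟨ sum-const (suc q) (Row Z zero) ⟩
  + suc q * Row Z zero      ∎)

-- Identifying matrices with vectors of length n * n, so that linear conditions on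
-- matrices become homogeneous systems.

flatten : ∀ {n} → Mat n → Vector ℤ (n ℕ.* n)
flatten {n} M j = uncurry M (Fin.remQuot n j)

unflatten : ∀ {n} → Vector ℤ (n ℕ.* n) → Mat n
unflatten t u u' = t (Fin.combine u u')

dot-flatten : ∀ {n} (M : Mat n) (t : Vector ℤ (n ℕ.* n)) → dot (flatten M) t ≡ ⟪ M , unflatten t ⟫
dot-flatten {n} M t = trans (sum-combine {n} (λ j → flatten M j * t j))
  (sum-cong-≗ λ u → sum-cong-≗ λ u' → cong (λ (uu' : Fin n × Fin n) → uncurry M uu' * t (Fin.combine u u'))
                                           (Fin.remQuot-combine u u'))

unflatten-nonzero : ∀ {n} (t : Vector ℤ (n ℕ.* n)) → Nonzero t → ∃ λ u → ∃ λ u' → ¬ unflatten t u u' ≡ 0ℤ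
unflatten-nonzero {n} t (j , tⱼ≢0) =
  proj₁ (Fin.remQuot {n} n j) , proj₂ (Fin.remQuot {n} n j) ,
  λ Z≡0 → tⱼ≢0 (trans (cong t (sym (Fin.combine-remQuot {n} n j))) Z≡0)

χ : ∀ {n} → Subset n → Vector ℤ n
χ S u = if lookup S u then 1ℤ else 0ℤ

χ-indicator : ∀ {n} (S : Subset n) (u : Fin n) → Indicator (χ S u) (u ∈ S)
χ-indicator S u with lookup S u in Sᵤ
... | true  = inj₁ (refl , lookup⇒[]= u S Sᵤ)
... | false = inj₂ (refl , λ u∈S → contradiction (trans (sym ([]=⇒lookup u∈S)) Sᵤ) λ ())

adj : ∀ {n} → Biclique n → Mat n
adj B = symOuter (χ (Biclique.X B)) (χ (Biclique.Y B))

-- Since X and Y are disjoint, adj B u v indicates that uv is an edge of B.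
adj-indicator : ∀ {n} (B : Biclique n) (u v : Fin n) →
  Indicator (adj B u v) ((u ∈ Biclique.X B × v ∈ Biclique.Y B) ⊎ (u ∈ Biclique.Y B × v ∈ Biclique.X B))
adj-indicator (biclique X Y _ _ disjoint) u v =
  indicator-+ (λ { ((u∈X , _) , (u∈Y , _)) → disjoint (u , x∈p∩q⁺ (u∈X , u∈Y)) })
    (indicator-* (χ-indicator X u) (χ-indicator Y v))
    (indicator-* (χ-indicator Y u) (χ-indicator X v))

adj-diag : ∀ {n} (B : Biclique n) (u : Fin n) → adj B u u ≡ 0ℤ
adj-diag B@(biclique X Y _ _ disjoint) u = indicator-false (adj-indicator B u u) λ where
  (inj₁ (u∈X , u∈Y)) → disjoint (u , x∈p∩q⁺ (u∈X , u∈Y))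
  (inj₂ (u∈Y , u∈X)) → disjoint (u , x∈p∩q⁺ (u∈X , u∈Y))

edge-between : ∀ {n} {u v : Fin n} → ¬ u ≡ v →
               ∃ λ (e : Edge n) → ∀ B → adj B u v ≡ adj B (Edge.u e) (Edge.v e)
edge-between {u = u} {v} u≢v with Fin.<-cmp u v
... | tri< u<v _ _ = edge u v u<v , λ B → refl
... | tri≈ _ u≡v _ = contradiction u≡v u≢v
... | tri> _ _ v<u = edge v u v<u , λ B →
  swap (χ (Biclique.X B) u) (χ (Biclique.Y B) v) (χ (Biclique.Y B) u) (χ (Biclique.X B) v)
  where
  swap : ∀ a b c d → a * b + c * d ≡ d * c + b * a
  swap = solve-∀

module Partition {n k} (P : Fin k → Block n) (partition : IsPartition P) where

  B₁ B₂ : Fin k → Biclique n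
  B₁ i = proj₁ (P i)
  B₂ i = proj₂ (P i)

  partition-identity : ∀ u u' v v' → ∑[ i < k ] (adj (B₁ i) ⊗ adj (B₂ i)) u u' v v' ≡ (adjK ⊗ adjK) u u' v v'
  partition-identity u u' v v' = by-cases (u Fin.≟ v) (u' Fin.≟ v')
    where
    by-cases : Dec (u ≡ v) → Dec (u' ≡ v') → ∑[ i < k ] (adj (B₁ i) u v * adj (B₂ i) u' v') ≡ adjK u v * adjK u' v'
    by-cases (yes refl) _ =
      trans (sum-zero _ λ i → trans (cong (_* adj (B₂ i) u' v') (adj-diag (B₁ i) u)) (*-zeroˡ (adj (B₂ i) u' v')))
            (sym (trans (cong (_* adjK u' v') (adjK-diag u)) (*-zeroˡ (adjK u' v'))))
    by-cases (no _) (yes refl) =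
      trans (sum-zero _ λ i → trans (cong (adj (B₁ i) u v *_) (adj-diag (B₂ i) u')) (*-zeroʳ (adj (B₁ i) u v)))
            (sym (trans (cong (adjK u v *_) (adjK-diag u')) (*-zeroʳ (adjK u v))))
    by-cases (no u≢v) (no u'≢v') = begin
      ∑[ i < k ] (adj (B₁ i) u v * adj (B₂ i) u' v')
        ≡⟨ sum-cong-≗ (λ i → cong₂ _*_ (on-e (B₁ i)) (on-f (B₂ i))) ⟩
      ∑[ i < k ] z i                        ≡⟨ sum-cong-≗ (λ i → *-identityʳ (z i)) ⟨
      ∑[ i < k ] (z i * 1ℤ)                 ≡⟨ sum-select z (λ _ → 1ℤ) z-indicates i₀ in-i₀ unique ⟩
      1ℤ                                    ≡⟨ cong₂ _*_ (adjK-distinct u≢v) (adjK-distinct u'≢v') ⟨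
      adjK u v * adjK u' v'                 ∎
      where
      e = proj₁ (edge-between u≢v)
      on-e = proj₂ (edge-between u≢v)
      f = proj₁ (edge-between u'≢v')
      on-f = proj₂ (edge-between u'≢v')
      z : Vector ℤ k
      z i = adj (B₁ i) (Edge.u e) (Edge.v e) * adj (B₂ i) (Edge.u f) (Edge.v f)
      z-indicates : ∀ i → Indicator (z i) ((e , f) ∈Block P i)
      z-indicates i = indicator-* (adj-indicator (B₁ i) (Edge.u e) (Edge.v e)) (adj-indicator (B₂ i) (Edge.u f) (Edge.v f))
      i₀ = proj₁ (proj₁ (partition (e , f)))
      in-i₀ = proj₂ (proj₁ (partition (e , f)))
      unique = proj₂ (partition (e , f))

  quad-partition : ∀ Z → quad Z (adjK ⊗ adjK) ≡ ∑[ i < k ] quad Z (adj (B₁ i) ⊗ adj (B₂ i))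
  quad-partition Z = trans (sym (quad-cong Z partition-identity)) (quad-∑ Z (λ i → adj (B₁ i) ⊗ adj (B₂ i)))

module LowerBound {p k} (P : Fin k → Block (2 ℕ.+ p)) (partition : IsPartition P) where
  open Partition P partition

  q : ℕ
  q = suc p

  xForms yForms : Vector (Mat (suc q)) k
  xForms i = χ (Biclique.X (B₁ i)) ⊙ χ (Biclique.X (B₂ i))
  yForms i = χ (Biclique.Y (B₁ i)) ⊙ χ (Biclique.X (B₂ i))

  rowForms colForms : Vector (Mat (suc q)) q
  rowForms w u u' = δ (suc w) u - δ zero u
  colForms w u u' = δ (suc w) u' - δ zero u'

  blockForms : Vector (Mat (suc q)) (k ℕ.+ k)
  blockForms = xForms ++ yForms

  balanceForms : Vector (Mat (suc q)) (q ℕ.+ q)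
  balanceForms = rowForms ++ colForms

  forms : Vector (Mat (suc q)) ((k ℕ.+ k) ℕ.+ (q ℕ.+ q))
  forms = blockForms ++ balanceForms

  -- Only the zero matrix is annihilated by all these forms: its row and column
  -- sums all equal some c, the quadratic form of adjK ⊗ adjK vanishes on it since
  -- every block's does, and by quad-adjK this forces Σ Z(u,u')² = 0.
  annihilated⇒zero : ∀ Z → (∀ i → ⟪ forms i , Z ⟫ ≡ 0ℤ) → ∀ u u' → Z u u' ≡ 0ℤ
  annihilated⇒zero Z annihilated = pairing-self-zero Z ZZ≡0
    where
    Annihilates : Mat (suc q) → Set
    Annihilates M = ⟪ M , Z ⟫ ≡ 0ℤ

    onBlocks = all-++ {Q = Annihilates} blockForms balanceForms annihilated
    onX = proj₁ (all-++ {Q = Annihilates} xForms yForms (proj₁ onBlocks))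
    onY = proj₂ (all-++ {Q = Annihilates} xForms yForms (proj₁ onBlocks))
    onRows = proj₁ (all-++ {Q = Annihilates} rowForms colForms (proj₂ onBlocks))
    onCols = proj₂ (all-++ {Q = Annihilates} rowForms colForms (proj₂ onBlocks))

    rows : ∀ u → Row Z u ≡ Row Z zero
    rows zero    = refl
    rows (suc w) = i-j≡0⇒i≡j _ _ (trans (sym (pairing-rowDiff (suc w) zero Z)) (onRows w))

    cols : ∀ u → Col Z u ≡ Col Z zero
    cols zero    = refl
    cols (suc w) = i-j≡0⇒i≡j _ _ (trans (sym (pairing-colDiff (suc w) zero Z)) (onCols w))

    c : ℤ
    c = Row Z zero

    quad-zero : quad Z (adjK ⊗ adjK) ≡ 0ℤ
    quad-zero = trans (quad-partition Z) (sum-zero _ λ i →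
      quad-symOuter-vanishes Z (χ (Biclique.X (B₁ i))) (χ (Biclique.Y (B₁ i)))
                               (χ (Biclique.X (B₂ i))) (χ (Biclique.Y (B₂ i))) (onX i) (onY i))

    ZZ≡0 : ⟪ Z , Z ⟫ ≡ 0ℤ
    ZZ≡0 = proj₂ (nonneg-+-zero (complete-term-nonneg p c) (pairing-self-nonneg Z)
      (trans (sym (quad-adjK Z c rows λ u → trans (cols u) (balanced Z rows cols))) quad-zero))

  -- There are 2k + 2q forms on the (q + 1)²-dimensional space of matrices, so if
  -- 2k ≤ q² some nonzero matrix is annihilated by all of them; hence 2k > q².
  many-blocks : q ℕ.* q ℕ.< k ℕ.+ k
  many-blocks with k ℕ.+ k ℕ.≤? q ℕ.* q
  ... | no 2k≰q² = ℕ.≰⇒> 2k≰q²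
  ... | yes 2k≤q² =
    let t , t≢0 , solves = underdetermined-solution (fewer-forms 2k≤q²) (λ i → flatten (forms i))
        u , u' , Zᵤᵤ'≢0 = unflatten-nonzero t t≢0
        annihilated i = trans (sym (dot-flatten (forms i) t)) (solves i)
    in contradiction (annihilated⇒zero (unflatten t) annihilated u u') Zᵤᵤ'≢0
    where
    fewer-forms : k ℕ.+ k ℕ.≤ q ℕ.* q → (k ℕ.+ k) ℕ.+ (q ℕ.+ q) ℕ.< suc q ℕ.* suc q
    fewer-forms 2k≤q² =
      subst (suc ((k ℕ.+ k) ℕ.+ (q ℕ.+ q)) ℕ.≤_) (square-suc q) (s≤s (ℕ.+-monoˡ-≤ (q ℕ.+ q) 2k≤q²))
      where
      square-suc : ∀ q → suc (q ℕ.* q ℕ.+ (q ℕ.+ q)) ≡ suc q ℕ.* suc q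
      square-suc = ℕSolver.solve-∀

proposition6 : (n : ℕ) → 2 ≤ n → (k : ℕ) → (P : Fin k → Block n) → IsPartition P →
                 ⌈ ((n ∸ 1) ^ 2 ℕ.+ 1) /2⌉ ≤ k
proposition6 (suc (suc p)) (s≤s (s≤s _)) k P partition =
  subst₂ _≤_ (cong ⌈_/2⌉ (sym (square-plus-one (suc p)))) (sym (ℕ.n≡⌈n+n/2⌉ k))
             (ℕ.⌈n/2⌉-mono (LowerBound.many-blocks P partition))
  where
  square-plus-one : ∀ q → q ^ 2 ℕ.+ 1 ≡ suc (q ℕ.* q)
  square-plus-one q = trans (ℕ.+-comm (q ^ 2) 1) (cong (λ x → suc (q ℕ.* x)) (ℕ.*-identityʳ q))
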